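{- Let $\tau=\tau^0\mbox{ - }\tau^1\mbox{ - }\cdots\mbox{ - }\tau^s$ and $\phi=\phi^0\mbox{ - }\phi^1\mbox{ - }\cdots\mbox{ - }\phi^s$ be multi-patterns such that the sequence $(\tau^0,\tau^1,\dots,\tau^s)$ is a rearrangement of the sequence $(\phi^0,\phi^1,\dots,\phi^s)$. Then $\tau\equiv\phi$.
   Context: $[k]^n$ = words of length $n$ over $\{1,\dots,k\}$. A generalized pattern with no hyphens is a word over $[m]$ using every letter of $[m]$. A multi-pattern $\tau^0\mbox{ - }\tau^1\mbox{ - }\cdots\mbox{ - }\tau^s$ (each $\tau^i$ a generalized pattern with no hyphens) is the pattern obtained by concatenating the $\tau^i$ with hyphens between consecutive blocks, where every letter of $\tau^i$ is incomparable with every letter of $\tau^j$ for $i\ne j$. A word $\sigma$ contains it if $\sigma$ has occurrences (as factors of consecutive letters, order-isomorphic to the block, with equalities preserved) of $\tau^0,\dots,\tau^s$ in this left-to-right order, pairwise non-overlapping; otherwise $\sigma$ avoids it. Two patterns are equivalent ($\equiv$) if for every $k$ and $n$ the numbers of words in $[k]^n$ avoiding them are equal. -}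

module Defs where

open import Data.Nat using (ℕ; zero; suc; _≤_; _<ᵇ_; _≡ᵇ_; _≤ᵇ_)
open import Data.Bool using (Bool; true; false; _∧_; _∨_; if_then_else_)
open import Data.List using (List; []; _∷_; length; map; concatMap; upTo; zip; take; drop; filter)
open import Data.List.Relation.Unary.All using (All)
open import Data.List.Membership.Propositional using (_∈_)
open import Data.Product using (Σ; _×_; _,_)
open import Relation.Binary.PropositionalEquality using (_≡_; _≢_)
open import Relation.Nullary using (¬_)
open import Data.Bool.Properties using () renaming (T? to T?)
open import Data.Bool using (T)

-- Words are lists of natural numbers; letters of [k] are 1,…,k.

letters : ℕ → List ℕ
letters k = map suc (upTo k)

allWords : ℕ → ℕ → List (List ℕ)
allWords k zero = [] ∷ []
allWords k (suc n) = concatMap (λ w → map (λ a → a ∷ w) (letters k)) (allWords k n)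

IsGenPattern : List ℕ → Set
IsGenPattern τ = Σ ℕ λ m →
  All (λ a → 1 ≤ a × a ≤ m) τ × (∀ a → 1 ≤ a → a ≤ m → a ∈ τ)

-- A multi-pattern τ⁰-τ¹-…-τˢ, represented by the list of its blocks (s+1 ≥ 1 blocks)
IsMultiPattern : List (List ℕ) → Set
IsMultiPattern ts = (ts ≢ []) × All IsGenPattern ts

allᵇ : {A : Set} → (A → Bool) → List A → Bool
allᵇ p [] = true
allᵇ p (x ∷ xs) = p x ∧ allᵇ p xs

_==_ : Bool → Bool → Bool
true == b = b
false == b = if b then false else true

isoPrefix : List ℕ → List ℕ → Bool
isoPrefix τ w =
  (length τ ≤ᵇ length w) ∧
  allᵇ (λ { (a , b) → allᵇ (λ { (c , d) → ((a <ᵇ c) == (b <ᵇ d)) ∧ ((a ≡ᵇ c) == (b ≡ᵇ d)) }) ps }) ps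
  where ps = zip τ (take (length τ) w)

-- σ contains the multi-pattern with blocks ts: occurrences of the blocks as factors,
-- in left-to-right order, pairwise non-overlapping.
containsᵇ : List (List ℕ) → List ℕ → Bool
containsᵇ [] σ = true
containsᵇ (τ ∷ ts) [] = isoPrefix τ [] ∧ containsᵇ ts []
containsᵇ (τ ∷ ts) (x ∷ σ) =
  (isoPrefix τ (x ∷ σ) ∧ containsᵇ ts (drop (length τ) (x ∷ σ))) ∨ containsᵇ (τ ∷ ts) σ

Avoids : List (List ℕ) → List ℕ → Set
Avoids ts σ = ¬ T (containsᵇ ts σ)

avoidCount : List (List ℕ) → ℕ → ℕ → ℕ
avoidCount ts k n = length (filter (λ σ → Relation.Nullary.¬? (T? (containsᵇ ts σ))) (allWords k n))
  where import Relation.Nullary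

_≡ₚ_ : List (List ℕ) → List (List ℕ) → Set
τ ≡ₚ φ = ∀ k n → avoidCount τ k n ≡ avoidCount φ k n

{-# OPTIONS --safe #-}
module Submission where

-- A word contains τ⁰-τ¹-…-τˢ iff it splits as u ++ v with u containing τ⁰ and v containing
-- τ¹-…-τˢ, the blocks being matched independently of each other.  Cutting right after the first
-- occurrence of τ⁰ makes the split unique, with u minimal: no proper prefix of u contains τ⁰.
-- Hence the number of words of length n containing τ ∷ ts is the Cauchy product
-- (minimalCount τ ⋆ count (containsᵇ ts)) n.  As ⋆ is associative and commutative, this number
-- depends only on the multiset of blocks, and so does its complement, the number of avoiders.

open import Defs
open import Data.Nat using (ℕ)
open import Data.List using (List)
open import Data.List.Relation.Binary.Permutation.Propositional using (_↭_)

open import Data.Bool using (Bool; true; false; T; not; _∧_; _∨_)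
open import Data.Bool.Properties using (T-≡; T-∧; T-∨; T?; _≟_; ¬-not)
open import Data.Empty using (⊥-elim)
open import Data.List using ([]; _∷_; _++_; length; take; drop; map; concatMap; filter; zip; [_])
open import Data.List.Properties
  using (++-assoc; take++drop≡id; drop-[]; take-take; length-take; length-++-≤ˡ; map-cong; map-∘; map-++)
import Data.List.Relation.Binary.Permutation.Propositional as ↭
open import Data.Nat using (zero; suc; _+_; _*_; _≤_; _≤ᵇ_; _<ᵇ_; _≡ᵇ_; s≤s)
open import Data.Nat.ListAction using (sum)
open import Data.Nat.ListAction.Properties using (sum-++)
open import Data.Nat.Properties
  using ( +-identityʳ; *-identityˡ; +-comm; +-assoc; +-suc; *-comm; *-assoc; *-distribˡ-+; *-distribʳ-+
        ; +-cancelʳ-≡; ≤-reflexive; ≤-trans; ≤ᵇ⇒≤; ≤⇒≤ᵇ; m≤n⇒m⊓n≡m; ⊓-idem; +-commutativeSemigroup)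
open import Algebra.Properties.CommutativeSemigroup +-commutativeSemigroup using (interchange; x∙yz≈y∙xz)
open import Data.Product using (∃₂; _×_; _,_; proj₁)
open import Data.Sum using (inj₁; inj₂)
open import Function using (_∘_; const)
open import Function.Bundles using (module Equivalence)
open import Relation.Binary.PropositionalEquality
  using (_≡_; refl; sym; trans; cong; cong₂; subst; _≗_; module ≡-Reasoning)
open import Relation.Nullary using (yes; no; ¬?)

open Equivalence using (to; from)

private
  variable
    A B : Set

T-ext : ∀ {b c} → (T b → T c) → (T c → T b) → b ≡ c
T-ext {false} {false} _ _ = refl
T-ext {false} {true}  _ g = ⊥-elim (g _)
T-ext {true}  {false} f _ = ⊥-elim (f _)
T-ext {true}  {true}  _ _ = refl

indicator : Bool → ℕ
indicator true  = 1
indicator false = 0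

indicator-∧ : ∀ a b → indicator (a ∧ b) ≡ indicator a * indicator b
indicator-∧ true  b = sym (+-identityʳ (indicator b))
indicator-∧ false b = refl

take-++-≤ : ∀ n (xs ys : List A) → n ≤ length xs → take n (xs ++ ys) ≡ take n xs
take-++-≤ zero    xs       ys _         = refl
take-++-≤ (suc n) (x ∷ xs) ys (s≤s n≤) = cong (x ∷_) (take-++-≤ n xs ys n≤)

drop-++-≤ : ∀ n (xs ys : List A) → n ≤ length xs → drop n (xs ++ ys) ≡ drop n xs ++ ys
drop-++-≤ zero    xs       ys _         = refl
drop-++-≤ (suc n) (x ∷ xs) ys (s≤s n≤) = drop-++-≤ n xs ys n≤

length-filter-¬+sum-indicator : ∀ (P : A → Bool) xs →
  length (filter (λ x → ¬? (T? (P x))) xs) + sum (map (indicator ∘ P) xs) ≡ length xs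
length-filter-¬+sum-indicator P [] = refl
length-filter-¬+sum-indicator P (x ∷ xs) with P x
... | true  = trans (+-suc _ _) (cong suc (length-filter-¬+sum-indicator P xs))
... | false = cong suc (length-filter-¬+sum-indicator P xs)

sum-map-zero : ∀ {f : A → ℕ} → f ≗ const 0 → ∀ xs → sum (map f xs) ≡ 0
sum-map-zero f≡0 []       = refl
sum-map-zero f≡0 (x ∷ xs) = cong₂ _+_ (f≡0 x) (sum-map-zero f≡0 xs)

sum-map-+ : ∀ (f g : A → ℕ) xs → sum (map (λ x → f x + g x) xs) ≡ sum (map f xs) + sum (map g xs)
sum-map-+ f g []       = refl
sum-map-+ f g (x ∷ xs) =
  trans (cong (f x + g x +_) (sum-map-+ f g xs)) (interchange (f x) (g x) _ _)

sum-map-*ʳ : ∀ (f : A → ℕ) c xs → sum (map (λ x → f x * c) xs) ≡ sum (map f xs) * c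
sum-map-*ʳ f c []       = refl
sum-map-*ʳ f c (x ∷ xs) =
  trans (cong (f x * c +_) (sum-map-*ʳ f c xs)) (sym (*-distribʳ-+ c (f x) _))

sum-map-concatMap : ∀ (f : B → ℕ) (g : A → List B) xs →
                    sum (map f (concatMap g xs)) ≡ sum (map (λ x → sum (map f (g x))) xs)
sum-map-concatMap f g []       = refl
sum-map-concatMap f g (x ∷ xs) = begin
  sum (map f (g x ++ concatMap g xs))                ≡⟨ cong sum (map-++ f (g x) _) ⟩
  sum (map f (g x) ++ map f (concatMap g xs))        ≡⟨ sum-++ (map f (g x)) _ ⟩
  sum (map f (g x)) + sum (map f (concatMap g xs))
    ≡⟨ cong (sum (map f (g x)) +_) (sum-map-concatMap f g xs) ⟩
  sum (map (λ x → sum (map f (g x))) (x ∷ xs))       ∎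
  where open ≡-Reasoning

sum-map-comm : ∀ (h : A → B → ℕ) xs ys →
               sum (map (λ x → sum (map (h x) ys)) xs) ≡ sum (map (λ y → sum (map (λ x → h x y) xs)) ys)
sum-map-comm h []       ys = sym (sum-map-zero (λ _ → refl) ys)
sum-map-comm h (x ∷ xs) ys =
  trans (cong (sum (map (h x) ys) +_) (sum-map-comm h xs ys)) (sym (sum-map-+ (h x) _ ys))

-- The Cauchy product: (f ⋆ g) n = ∑_{i + j = n} f i * g j.
infixl 7 _⋆_

_⋆_ : (ℕ → ℕ) → (ℕ → ℕ) → ℕ → ℕ
(f ⋆ g) zero    = f 0 * g 0
(f ⋆ g) (suc n) = f 0 * g (suc n) + ((f ∘ suc) ⋆ g) n

⋆-cong : ∀ {f f′ g g′} → f ≗ f′ → g ≗ g′ → f ⋆ g ≗ f′ ⋆ g′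
⋆-cong f≗f′ g≗g′ zero    = cong₂ _*_ (f≗f′ 0) (g≗g′ 0)
⋆-cong f≗f′ g≗g′ (suc n) =
  cong₂ _+_ (cong₂ _*_ (f≗f′ 0) (g≗g′ (suc n))) (⋆-cong (f≗f′ ∘ suc) g≗g′ n)

⋆-congˡ : ∀ {f g g′} → g ≗ g′ → f ⋆ g ≗ f ⋆ g′
⋆-congˡ = ⋆-cong (λ _ → refl)

⋆-congʳ : ∀ {f f′ g} → f ≗ f′ → f ⋆ g ≗ f′ ⋆ g
⋆-congʳ f≗f′ = ⋆-cong f≗f′ (λ _ → refl)

⋆-zeroˡ : ∀ {f} g → f ≗ const 0 → f ⋆ g ≗ const 0
⋆-zeroˡ g f≡0 zero    = cong (_* g 0) (f≡0 0)
⋆-zeroˡ g f≡0 (suc n) = cong₂ _+_ (cong (_* g (suc n)) (f≡0 0)) (⋆-zeroˡ g (f≡0 ∘ suc) n)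

⋆-identityˡ : ∀ {f} g → f 0 ≡ 1 → (∀ m → f (suc m) ≡ 0) → f ⋆ g ≗ g
⋆-identityˡ g f0≡1 _ zero = trans (cong (_* g 0) f0≡1) (*-identityˡ (g 0))
⋆-identityˡ {f} g f0≡1 f≡0 (suc n) = begin
  f 0 * g (suc n) + ((f ∘ suc) ⋆ g) n   ≡⟨ cong₂ _+_ (cong (_* g (suc n)) f0≡1) (⋆-zeroˡ g f≡0 n) ⟩
  1 * g (suc n) + 0                     ≡⟨ +-identityʳ _ ⟩
  1 * g (suc n)                         ≡⟨ *-identityˡ _ ⟩
  g (suc n)                             ∎
  where open ≡-Reasoning

⋆-distribʳ-+ : ∀ f f′ g → (λ m → f m + f′ m) ⋆ g ≗ λ n → (f ⋆ g) n + (f′ ⋆ g) n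
⋆-distribʳ-+ f f′ g zero    = *-distribʳ-+ (g 0) (f 0) (f′ 0)
⋆-distribʳ-+ f f′ g (suc n) =
  trans (cong₂ _+_ (*-distribʳ-+ (g (suc n)) (f 0) (f′ 0)) (⋆-distribʳ-+ (f ∘ suc) (f′ ∘ suc) g n))
        (interchange (f 0 * g (suc n)) (f′ 0 * g (suc n)) (((f ∘ suc) ⋆ g) n) (((f′ ∘ suc) ⋆ g) n))

⋆-distribʳ-sum : ∀ (h : A → ℕ → ℕ) xs g →
                 (λ m → sum (map (λ a → h a m) xs)) ⋆ g ≗ λ n → sum (map (λ a → (h a ⋆ g) n) xs)
⋆-distribʳ-sum h xs g zero    = sym (sum-map-*ʳ (λ a → h a 0) (g 0) xs)
⋆-distribʳ-sum h xs g (suc n) =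
  trans (cong₂ _+_ (sym (sum-map-*ʳ (λ a → h a 0) (g (suc n)) xs)) (⋆-distribʳ-sum (λ a → h a ∘ suc) xs g n))
        (sym (sum-map-+ (λ a → h a 0 * g (suc n)) (λ a → ((h a ∘ suc) ⋆ g) n) xs))

⋆-*ˡ : ∀ c f g → (λ m → c * f m) ⋆ g ≗ λ n → c * (f ⋆ g) n
⋆-*ˡ c f g zero    = *-assoc c (f 0) (g 0)
⋆-*ˡ c f g (suc n) =
  trans (cong₂ _+_ (*-assoc c (f 0) (g (suc n))) (⋆-*ˡ c (f ∘ suc) g n)) (sym (*-distribˡ-+ c _ _))

⋆-assoc : ∀ f g h → (f ⋆ g) ⋆ h ≗ f ⋆ (g ⋆ h)
⋆-assoc f g h zero    = *-assoc (f 0) (g 0) (h 0)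
⋆-assoc f g h (suc n) = begin
  f 0 * g 0 * h (suc n) + (((f ⋆ g) ∘ suc) ⋆ h) n
    ≡⟨ cong (f 0 * g 0 * h (suc n) +_) (⋆-distribʳ-+ (λ m → f 0 * g (suc m)) ((f ∘ suc) ⋆ g) h n) ⟩
  f 0 * g 0 * h (suc n) + (((λ m → f 0 * g (suc m)) ⋆ h) n + (((f ∘ suc) ⋆ g) ⋆ h) n)
    ≡⟨ cong₂ (λ x y → f 0 * g 0 * h (suc n) + (x + y)) (⋆-*ˡ (f 0) (g ∘ suc) h n) (⋆-assoc (f ∘ suc) g h n) ⟩
  f 0 * g 0 * h (suc n) + (f 0 * ((g ∘ suc) ⋆ h) n + ((f ∘ suc) ⋆ (g ⋆ h)) n)
    ≡⟨ sym (+-assoc (f 0 * g 0 * h (suc n)) (f 0 * ((g ∘ suc) ⋆ h) n) _) ⟩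
  f 0 * g 0 * h (suc n) + f 0 * ((g ∘ suc) ⋆ h) n + ((f ∘ suc) ⋆ (g ⋆ h)) n
    ≡⟨ cong (_+ ((f ∘ suc) ⋆ (g ⋆ h)) n)
         (trans (cong (_+ f 0 * ((g ∘ suc) ⋆ h) n) (*-assoc (f 0) (g 0) (h (suc n))))
                (sym (*-distribˡ-+ (f 0) (g 0 * h (suc n)) (((g ∘ suc) ⋆ h) n)))) ⟩
  f 0 * (g ⋆ h) (suc n) + ((f ∘ suc) ⋆ (g ⋆ h)) n
    ∎
  where open ≡-Reasoning

⋆-sucʳ : ∀ f g n → (f ⋆ g) (suc n) ≡ f (suc n) * g 0 + (f ⋆ (g ∘ suc)) n
⋆-sucʳ f g zero    = +-comm (f 0 * g 1) _
⋆-sucʳ f g (suc n) =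
  trans (cong (f 0 * g (suc (suc n)) +_) (⋆-sucʳ (f ∘ suc) g n))
        (x∙yz≈y∙xz (f 0 * g (suc (suc n))) (f (suc (suc n)) * g 0) (((f ∘ suc) ⋆ (g ∘ suc)) n))

⋆-comm : ∀ f g → f ⋆ g ≗ g ⋆ f
⋆-comm f g zero    = *-comm (f 0) (g 0)
⋆-comm f g (suc n) = begin
  f 0 * g (suc n) + ((f ∘ suc) ⋆ g) n    ≡⟨ cong₂ _+_ (*-comm (f 0) _) (⋆-comm (f ∘ suc) g n) ⟩
  g (suc n) * f 0 + (g ⋆ (f ∘ suc)) n    ≡⟨ sym (⋆-sucʳ g f n) ⟩
  (g ⋆ f) (suc n)                        ∎
  where open ≡-Reasoning

⋆-left-comm : ∀ f g h → f ⋆ (g ⋆ h) ≗ g ⋆ (f ⋆ h)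
⋆-left-comm f g h n = begin
  (f ⋆ (g ⋆ h)) n   ≡⟨ sym (⋆-assoc f g h n) ⟩
  ((f ⋆ g) ⋆ h) n   ≡⟨ ⋆-congʳ (⋆-comm f g) n ⟩
  ((g ⋆ f) ⋆ h) n   ≡⟨ ⋆-assoc g f h n ⟩
  (g ⋆ (f ⋆ h)) n   ∎
  where open ≡-Reasoning

module _ {A : Set} where

  Concat : (List A → Bool) → (List A → Bool) → List A → Bool
  Concat L M []      = L [] ∧ M []
  Concat L M (a ∷ w) = (L [] ∧ M (a ∷ w)) ∨ Concat (L ∘ (a ∷_)) M w

  Minimal : (List A → Bool) → List A → Bool
  Minimal L []      = L []
  Minimal L (a ∷ w) = not (L []) ∧ Minimal (L ∘ (a ∷_)) w

  Concat-∷ : ∀ L M → L [] ≡ false → ∀ a → Concat L M ∘ (a ∷_) ≗ Concat (L ∘ (a ∷_)) M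
  Concat-∷ L M L[] a w = cong (λ b → (b ∧ M (a ∷ w)) ∨ Concat (L ∘ (a ∷_)) M w) L[]

  Minimal-∷ : ∀ L → L [] ≡ false → ∀ a → Minimal L ∘ (a ∷_) ≗ Minimal (L ∘ (a ∷_))
  Minimal-∷ L L[] a w = cong (λ b → not b ∧ Minimal (L ∘ (a ∷_)) w) L[]

  Minimal-∷-nullable : ∀ L → L [] ≡ true → ∀ a → Minimal L ∘ (a ∷_) ≗ const false
  Minimal-∷-nullable L L[] a w = cong (λ b → not b ∧ Minimal (L ∘ (a ∷_)) w) L[]

  PrependClosed : (List A → Bool) → Set
  PrependClosed L = ∀ {a w} → T (L w) → T (L (a ∷ w))

  PrependClosed-++ : ∀ {M} → PrependClosed M → ∀ u {v} → T (M v) → T (M (u ++ v))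
  PrependClosed-++ closed []      Mv = Mv
  PrependClosed-++ {M} closed (a ∷ u) Mv = closed (PrependClosed-++ {M} closed u Mv)

  Concat⇒split : ∀ L M w → T (Concat L M w) → ∃₂ λ u v → w ≡ u ++ v × T (L u) × T (M v)
  Concat⇒split L M []      LM = [] , [] , refl , to T-∧ LM
  Concat⇒split L M (a ∷ w) LM with to (T-∨ {L [] ∧ M (a ∷ w)}) LM
  ... | inj₁ here  = [] , a ∷ w , refl , to T-∧ here
  ... | inj₂ later with Concat⇒split (L ∘ (a ∷_)) M w later
  ...   | u , v , refl , Lau , Mv = a ∷ u , v , refl , Lau , Mv

  split⇒Concat : ∀ L M u v → T (L u) → T (M v) → T (Concat L M (u ++ v))
  split⇒Concat L M []      []      Lu Mv = from T-∧ (Lu , Mv)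
  split⇒Concat L M []      (b ∷ v) Lu Mv = from T-∨ (inj₁ (from T-∧ (Lu , Mv)))
  split⇒Concat L M (a ∷ u) v       Lu Mv =
    from (T-∨ {L [] ∧ M (a ∷ u ++ v)}) (inj₂ (split⇒Concat (L ∘ (a ∷_)) M u v Lu Mv))

  Concat-nullable : ∀ {L M} → L [] ≡ true → PrependClosed M → Concat L M ≗ M
  Concat-nullable {L} {M} L[] closed w = T-ext Concat⇒M (split⇒Concat L M [] w (subst T (sym L[]) _))
    where
    Concat⇒M : T (Concat L M w) → T (M w)
    Concat⇒M LMw with Concat⇒split L M w LMw
    ... | u , v , refl , _ , Mv = PrependClosed-++ {M} closed u Mv

module Counting {A : Set} (alphabet : List A) where

  count : (List A → Bool) → ℕ → ℕ
  count P zero    = indicator (P [])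
  count P (suc n) = sum (map (λ a → count (P ∘ (a ∷_)) n) alphabet)

  count-cong : ∀ {P Q} → P ≗ Q → count P ≗ count Q
  count-cong P≗Q zero    = cong indicator (P≗Q [])
  count-cong P≗Q (suc n) = cong sum (map-cong (λ a → count-cong (P≗Q ∘ (a ∷_)) n) alphabet)

  count-suc : ∀ {P} {Q : A → List A → Bool} → (∀ a → P ∘ (a ∷_) ≗ Q a) →
              ∀ n → count P (suc n) ≡ sum (map (λ a → count (Q a) n) alphabet)
  count-suc P≗Q n = cong sum (map-cong (λ a → count-cong (P≗Q a) n) alphabet)

  count-false : ∀ {P} → P ≗ const false → count P ≗ const 0
  count-false P≗false zero    = cong indicator (P≗false [])
  count-false P≗false (suc n) = sum-map-zero (λ a → count-false (P≗false ∘ (a ∷_)) n) alphabet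

  count-Concat-nullable : ∀ {L M} → L [] ≡ true → PrependClosed M →
                          count (Concat L M) ≗ count (Minimal L) ⋆ count M
  count-Concat-nullable {L} {M} L[] closed n = begin
    count (Concat L M) n              ≡⟨ count-cong (Concat-nullable L[] closed) n ⟩
    count M n                         ≡⟨ ⋆-identityˡ (count M) (cong indicator L[]) nonempty-not-minimal n ⟨
    (count (Minimal L) ⋆ count M) n   ∎
    where
    open ≡-Reasoning
    nonempty-not-minimal : ∀ m → count (Minimal L) (suc m) ≡ 0
    nonempty-not-minimal m =
      sum-map-zero (λ a → count-false (Minimal-∷-nullable L L[] a) m) alphabet

  count-Concat : ∀ {M} → PrependClosed M → ∀ L → count (Concat L M) ≗ count (Minimal L) ⋆ count M
  count-Concat {M} closed L zero = indicator-∧ (L []) (M [])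
  count-Concat {M} closed L (suc n) with L [] ≟ true
  ... | yes L[] = count-Concat-nullable {L} L[] closed (suc n)
  ... | no L[]≢true = begin
    count (Concat L M) (suc n)
      ≡⟨ count-suc {Concat L M} (Concat-∷ L M L[]) n ⟩
    sum (map (λ a → count (Concat (L ∘ (a ∷_)) M) n) alphabet)
      ≡⟨ cong sum (map-cong (λ a → count-Concat closed (L ∘ (a ∷_)) n) alphabet) ⟩
    sum (map (λ a → (count (Minimal (L ∘ (a ∷_))) ⋆ count M) n) alphabet)
      ≡⟨ ⋆-distribʳ-sum (λ a → count (Minimal (L ∘ (a ∷_)))) alphabet (count M) n ⟨
    ((λ m → sum (map (λ a → count (Minimal (L ∘ (a ∷_))) m) alphabet)) ⋆ count M) n
      ≡⟨ ⋆-congʳ (count-suc {Minimal L} (Minimal-∷ L L[])) n ⟨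
    ((count (Minimal L) ∘ suc) ⋆ count M) n
      ≡⟨ cong (λ b → indicator b * count M (suc n) + ((count (Minimal L) ∘ suc) ⋆ count M) n) L[] ⟨
    (count (Minimal L) ⋆ count M) (suc n)
      ∎
    where
    open ≡-Reasoning
    L[] : L [] ≡ false
    L[] = ¬-not L[]≢true

-- The body of isoPrefix, restated so that its dependence on the word can be abstracted.
isoPrefix-cong : ∀ τ {u v} → length τ ≤ length u → length τ ≤ length v →
                 take (length τ) u ≡ take (length τ) v → isoPrefix τ u ≡ isoPrefix τ v
isoPrefix-cong τ τ≤u τ≤v =
  cong₂ (λ fits prefix → fits ∧ isoPairs (zip τ prefix)) (trans (≤ᵇ-true τ≤u) (sym (≤ᵇ-true τ≤v)))
  where
  ≤ᵇ-true : ∀ {m n} → m ≤ n → (m ≤ᵇ n) ≡ true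
  ≤ᵇ-true = to T-≡ ∘ ≤⇒≤ᵇ
  isoPairs : List (ℕ × ℕ) → Bool
  isoPairs ps = allᵇ (λ { (a , b) → allᵇ (λ { (c , d) → ((a <ᵇ c) == (b <ᵇ d)) ∧ ((a ≡ᵇ c) == (b ≡ᵇ d)) }) ps }) ps

isoPrefix-length : ∀ τ w → T (isoPrefix τ w) → length τ ≤ length w
isoPrefix-length τ w iso = ≤ᵇ⇒≤ (length τ) (length w) (proj₁ (to T-∧ iso))

isoPrefix-take : ∀ τ w → length τ ≤ length w → isoPrefix τ (take (length τ) w) ≡ isoPrefix τ w
isoPrefix-take τ w τ≤w = isoPrefix-cong τ
  (≤-reflexive (sym (trans (length-take n w) (m≤n⇒m⊓n≡m τ≤w)))) τ≤w
  (trans (take-take n n w) (cong (λ i → take i w) (⊓-idem n)))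
  where n = length τ

isoPrefix-++ : ∀ τ u v → length τ ≤ length u → isoPrefix τ (u ++ v) ≡ isoPrefix τ u
isoPrefix-++ τ u v τ≤u =
  isoPrefix-cong τ (≤-trans τ≤u (length-++-≤ˡ u)) τ≤u (take-++-≤ (length τ) u v τ≤u)

leadingOccurrence : List ℕ → List (List ℕ) → List ℕ → Bool
leadingOccurrence τ ts v = isoPrefix τ v ∧ containsᵇ ts (drop (length τ) v)

containsᵇ-∷ : ∀ τ ts → containsᵇ (τ ∷ ts) ≗ Concat (const true) (leadingOccurrence τ ts)
containsᵇ-∷ τ ts []      = cong (λ r → isoPrefix τ [] ∧ containsᵇ ts r) (sym (drop-[] (length τ)))
containsᵇ-∷ τ ts (x ∷ σ) = cong (leadingOccurrence τ ts (x ∷ σ) ∨_) (containsᵇ-∷ τ ts σ)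

containsᵇ-prependClosed : ∀ ts → PrependClosed (containsᵇ ts)
containsᵇ-prependClosed []       _ = _
containsᵇ-prependClosed (τ ∷ ts) h = from T-∨ (inj₂ h)

contains⇒occurrence : ∀ τ ts σ → T (containsᵇ (τ ∷ ts) σ) →
  ∃₂ λ u v → σ ≡ u ++ v × T (isoPrefix τ v) × T (containsᵇ ts (drop (length τ) v))
contains⇒occurrence τ ts σ h
  with Concat⇒split (const true) (leadingOccurrence τ ts) σ (subst T (containsᵇ-∷ τ ts σ) h)
... | u , v , σ≡uv , _ , occ with to T-∧ occ
...   | iso , rest = u , v , σ≡uv , iso , rest

occurrence⇒contains : ∀ τ ts u v → T (isoPrefix τ v) → T (containsᵇ ts (drop (length τ) v)) →
                      T (containsᵇ (τ ∷ ts) (u ++ v))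
occurrence⇒contains τ ts u v iso rest = subst T (sym (containsᵇ-∷ τ ts (u ++ v)))
  (split⇒Concat (const true) (leadingOccurrence τ ts) u v _ (from T-∧ (iso , rest)))

containsᵇ-∷⇒Concat : ∀ τ ts σ → T (containsᵇ (τ ∷ ts) σ) → T (Concat (containsᵇ [ τ ]) (containsᵇ ts) σ)
containsᵇ-∷⇒Concat τ ts σ h with contains⇒occurrence τ ts σ h
... | u , v , refl , iso , rest =
  subst (T ∘ Concat (containsᵇ [ τ ]) (containsᵇ ts)) uv-split
    (split⇒Concat (containsᵇ [ τ ]) (containsᵇ ts) (u ++ take n v) (drop n v) firstOccurrence rest)
  where
  n = length τ
  firstOccurrence : T (containsᵇ [ τ ] (u ++ take n v))
  firstOccurrence = occurrence⇒contains τ [] u (take n v)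
    (subst T (sym (isoPrefix-take τ v (isoPrefix-length τ v iso))) iso) _
  uv-split : (u ++ take n v) ++ drop n v ≡ u ++ v
  uv-split = trans (++-assoc u (take n v) (drop n v)) (cong (u ++_) (take++drop≡id n v))

Concat⇒containsᵇ-∷ : ∀ τ ts σ → T (Concat (containsᵇ [ τ ]) (containsᵇ ts) σ) → T (containsᵇ (τ ∷ ts) σ)
Concat⇒containsᵇ-∷ τ ts σ h with Concat⇒split (containsᵇ [ τ ]) (containsᵇ ts) σ h
... | u , w , refl , τ∈u , ts∈w with contains⇒occurrence τ [] u τ∈u
...   | u₁ , u₂ , refl , iso , _ =
  subst (T ∘ containsᵇ (τ ∷ ts)) (sym (++-assoc u₁ u₂ w))
    (occurrence⇒contains τ ts u₁ (u₂ ++ w) iso′ rest)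
  where
  n = length τ
  τ≤u₂ : n ≤ length u₂
  τ≤u₂ = isoPrefix-length τ u₂ iso
  iso′ : T (isoPrefix τ (u₂ ++ w))
  iso′ = subst T (sym (isoPrefix-++ τ u₂ w τ≤u₂)) iso
  rest : T (containsᵇ ts (drop n (u₂ ++ w)))
  rest = subst (T ∘ containsᵇ ts) (sym (drop-++-≤ n u₂ w τ≤u₂))
           (PrependClosed-++ {M = containsᵇ ts} (containsᵇ-prependClosed ts) (drop n u₂) ts∈w)

containsᵇ-∷-Concat : ∀ τ ts → containsᵇ (τ ∷ ts) ≗ Concat (containsᵇ [ τ ]) (containsᵇ ts)
containsᵇ-∷-Concat τ ts σ = T-ext (containsᵇ-∷⇒Concat τ ts σ) (Concat⇒containsᵇ-∷ τ ts σ)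

module _ (k : ℕ) where
  open Counting (letters k)

  count-allWords : ∀ P n → sum (map (indicator ∘ P) (allWords k n)) ≡ count P n
  count-allWords P zero    = +-identityʳ (indicator (P []))
  count-allWords P (suc n) = begin
    sum (map (indicator ∘ P) (concatMap (λ w → map (_∷ w) (letters k)) (allWords k n)))
      ≡⟨ sum-map-concatMap (indicator ∘ P) (λ w → map (_∷ w) (letters k)) (allWords k n) ⟩
    sum (map (λ w → sum (map (indicator ∘ P) (map (_∷ w) (letters k)))) (allWords k n))
      ≡⟨ cong sum (map-cong (λ w → cong sum (sym (map-∘ (letters k)))) (allWords k n)) ⟩
    sum (map (λ w → sum (map (λ a → indicator (P (a ∷ w))) (letters k))) (allWords k n))
      ≡⟨ sum-map-comm (λ w a → indicator (P (a ∷ w))) (allWords k n) (letters k) ⟩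
    sum (map (λ a → sum (map (λ w → indicator (P (a ∷ w))) (allWords k n))) (letters k))
      ≡⟨ cong sum (map-cong (λ a → count-allWords (P ∘ (a ∷_)) n) (letters k)) ⟩
    count P (suc n)
      ∎
    where open ≡-Reasoning

  avoidCount+count : ∀ ts n → avoidCount ts k n + count (containsᵇ ts) n ≡ length (allWords k n)
  avoidCount+count ts n = begin
    avoidCount ts k n + count (containsᵇ ts) n
      ≡⟨ cong (avoidCount ts k n +_) (sym (count-allWords (containsᵇ ts) n)) ⟩
    avoidCount ts k n + sum (map (indicator ∘ containsᵇ ts) (allWords k n))
      ≡⟨ length-filter-¬+sum-indicator (containsᵇ ts) (allWords k n) ⟩
    length (allWords k n)
      ∎
    where open ≡-Reasoning

  minimalCount : List ℕ → ℕ → ℕ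
  minimalCount τ = count (Minimal (containsᵇ [ τ ]))

  count-containsᵇ-∷ : ∀ τ ts → count (containsᵇ (τ ∷ ts)) ≗ minimalCount τ ⋆ count (containsᵇ ts)
  count-containsᵇ-∷ τ ts n = trans (count-cong (containsᵇ-∷-Concat τ ts) n)
                                   (count-Concat (containsᵇ-prependClosed ts) (containsᵇ [ τ ]) n)

  count-containsᵇ-↭ : ∀ {τ φ} → τ ↭ φ → count (containsᵇ τ) ≗ count (containsᵇ φ)
  count-containsᵇ-↭ ↭.refl n = refl
  count-containsᵇ-↭ (↭.prep {xs = ts} {ys = ts′} τ p) n = begin
    count (containsᵇ (τ ∷ ts)) n                 ≡⟨ count-containsᵇ-∷ τ ts n ⟩
    (minimalCount τ ⋆ count (containsᵇ ts)) n    ≡⟨ ⋆-congˡ (count-containsᵇ-↭ p) n ⟩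
    (minimalCount τ ⋆ count (containsᵇ ts′)) n   ≡⟨ count-containsᵇ-∷ τ ts′ n ⟨
    count (containsᵇ (τ ∷ ts′)) n                ∎
    where open ≡-Reasoning
  count-containsᵇ-↭ (↭.swap {xs = ts} {ys = ts′} τ τ′ p) n = begin
    count (containsᵇ (τ ∷ τ′ ∷ ts)) n                        ≡⟨ count-containsᵇ-∷ τ (τ′ ∷ ts) n ⟩
    (minimalCount τ ⋆ count (containsᵇ (τ′ ∷ ts))) n         ≡⟨ ⋆-congˡ (count-containsᵇ-∷ τ′ ts) n ⟩
    (minimalCount τ ⋆ (minimalCount τ′ ⋆ count (containsᵇ ts))) n
      ≡⟨ ⋆-congˡ (⋆-congˡ (count-containsᵇ-↭ p)) n ⟩
    (minimalCount τ ⋆ (minimalCount τ′ ⋆ count (containsᵇ ts′))) n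
      ≡⟨ ⋆-left-comm (minimalCount τ) (minimalCount τ′) (count (containsᵇ ts′)) n ⟩
    (minimalCount τ′ ⋆ (minimalCount τ ⋆ count (containsᵇ ts′))) n
      ≡⟨ ⋆-congˡ (count-containsᵇ-∷ τ ts′) n ⟨
    (minimalCount τ′ ⋆ count (containsᵇ (τ ∷ ts′))) n        ≡⟨ count-containsᵇ-∷ τ′ (τ ∷ ts′) n ⟨
    count (containsᵇ (τ′ ∷ τ ∷ ts′)) n                       ∎
    where open ≡-Reasoning
  count-containsᵇ-↭ (↭.trans p q) n = trans (count-containsᵇ-↭ p n) (count-containsᵇ-↭ q n)

mainTheorem8 : (τ φ : List (List ℕ)) → IsMultiPattern τ → IsMultiPattern φ →
               τ ↭ φ → τ ≡ₚ φ
mainTheorem8 τ φ _ _ τ↭φ k n = +-cancelʳ-≡ (count (containsᵇ φ) n) _ _ (begin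
  avoidCount τ k n + count (containsᵇ φ) n   ≡⟨ cong (avoidCount τ k n +_) (count-containsᵇ-↭ k τ↭φ n) ⟨
  avoidCount τ k n + count (containsᵇ τ) n   ≡⟨ avoidCount+count k τ n ⟩
  length (allWords k n)                      ≡⟨ avoidCount+count k φ n ⟨
  avoidCount φ k n + count (containsᵇ φ) n   ∎)
  where
  open ≡-Reasoning
  open Counting (letters k)
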